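{- Let $\alpha,\beta\in\mathbb F_q^*$. For all nonempty words $\mathfrak a,\mathfrak b\in\langle\Sigma\rangle$, $\varphi_\alpha(\mathfrak a)\diamond\varphi_\beta(\mathfrak b)=\varphi_{\alpha\beta}(\mathfrak a\diamond\mathfrak b)$ (with $\varphi_\gamma:\mathfrak C\to\mathfrak D$). Further, for all nonempty words $\mathfrak a,\mathfrak b\in\langle\Gamma\rangle$, $\varphi_\alpha(\mathfrak a)\diamond\varphi_\beta(\mathfrak b)=\varphi_{\alpha\beta}(\mathfrak a\diamond\mathfrak b)$ (with $\varphi_\gamma:\mathfrak D\to\mathfrak D$).
   Context: Let $q$ be a prime power, $\mathbb F_q$ the field with $q$ elements, $\mathbb N=\{1,2,\dots\}$. For positive integers $r,s,j$ put $\Delta^j_{r,s}=(-1)^{r-1}\binom{j-1}{r-1}+(-1)^{s-1}\binom{j-1}{s-1}\in\mathbb F_q$ if $(q-1)\mid j$ and $0$ otherwise. Words are finite strings of letters; the empty word is $1$. (i) Let $\Sigma=\{x_n:n\in\mathbb N\}$, $\langle\Sigma\rangle$ its set of words, $\mathfrak C$ the $\mathbb F_q$-vector space with basis $\langle\Sigma\rangle$. The bilinear products $\diamond,\sqcup\!\sqcup$ on $\mathfrak C$ are defined recursively by $1\diamond\mathfrak a=\mathfrak a\diamond1=\mathfrak a$, $1\sqcup\!\sqcup\mathfrak a=\mathfrak a\sqcup\!\sqcup1=\mathfrak a$, and for $\mathfrak a=x_a\mathfrak a_-$, $\mathfrak b=x_b\mathfrak b_-$: $\mathfrak a\diamond\mathfrak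 b=x_{a+b}(\mathfrak a_-\sqcup\!\sqcup\mathfrak b_-)+\sum_{i+j=a+b}\Delta^j_{a,b}x_i(x_j\sqcup\!\sqcup(\mathfrak a_-\sqcup\!\sqcup\mathfrak b_-))$ (over positive $i,j$), $\mathfrak a\sqcup\!\sqcup\mathfrak b=x_a(\mathfrak a_-\sqcup\!\sqcup\mathfrak b)+x_b(\mathfrak a\sqcup\!\sqcup\mathfrak b_-)+\mathfrak a\diamond\mathfrak b$. (ii) Let $\Gamma=\{x_{n,\varepsilon}:n\in\mathbb N,\varepsilon\in\mathbb F_q^*\}$, $\langle\Gamma\rangle$ its set of words, $\mathfrak D$ the $\mathbb F_q$-vector space with basis $\langle\Gamma\rangle$. The bilinear products $\diamond,\sqcup\!\sqcup$ on $\mathfrak D$ are defined recursively by $1\diamond\mathfrak a=\mathfrak a\diamond1=\mathfrak a$, $1\sqcup\!\sqcup\mathfrak a=\mathfrak a\sqcup\!\sqcup1=\mathfrak a$, and for $\mathfrak a=x_{a,\alpha}\mathfrak a_-$, $\mathfrak b=x_{b,\beta}\mathfrak b_-$: $\mathfrak a\diamond\mathfrak b=x_{a+b,\alpha\beta}(\mathfrak a_-\sqcup\!\sqcup\mathfrak b_-)+\sum_{i+j=a+b}\Delta^j_{a,b}x_{i,\alpha\beta}(x_{j,1}\sqcup\!\sqcup(\mathfrak a_-\sqcup\!\sqcup\mathfrak b_-))$, $\mathfrak a\sqcup\!\sqcup\mathfrak b=x_{a,\alpha}(\mathfrak a_-\sqcup\!\sqcup\mathfrak b)+x_{b,\beta}(\mathfrak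 a\sqcup\!\sqcup\mathfrak b_-)+\mathfrak a\diamond\mathfrak b$. (iii) Horizontal maps: for $\gamma\in\mathbb F_q^*$, $\varphi_\gamma:\mathfrak C\to\mathfrak D$ is linear with $\varphi_\gamma(1)=1$ and $\varphi_\gamma(x_{i_1}x_{i_2}\cdots x_{i_n})=x_{i_1,\gamma}x_{i_2,1}\cdots x_{i_n,1}$; and $\varphi_\gamma:\mathfrak D\to\mathfrak D$ is linear with $\varphi_\gamma(1)=1$ and $\varphi_\gamma(x_{u,\varepsilon}\mathfrak u_-)=x_{u,\gamma\varepsilon}\mathfrak u_-$ for nonempty words. -}

module Defs where

open import Level using (Level; _⊔_) renaming (suc to lsuc)
open import Algebra.Bundles using (CommutativeRing)
open import Function.Bundles using (Inverse)
open import Data.Nat as ℕ using (ℕ; zero; suc; _∸_)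
open import Data.Nat.Combinatorics using (_C_)
open import Data.Nat.Divisibility using (_∣?_)
open import Data.Fin using (Fin)
import Data.Fin as Fin
open import Data.Bool using (Bool; true; false; if_then_else_; _∧_)
open import Data.List using (List; []; _∷_; _++_; map; concatMap; foldr; length; upTo)
open import Data.Product using (Σ; _×_; _,_; proj₁; proj₂; ∃-syntax)
open import Relation.Nullary using (¬_; does)
import Relation.Binary.PropositionalEquality as ≡
import Relation.Binary.Reasoning.Setoid as SetoidReasoning

-- A finite field F_q: a commutative ring with 1 ≠ 0 in which every
-- nonzero element is invertible, together with a bijection
-- Fin q ≅ F (so q is the number of elements; q is then automatically
-- a prime power).

record FiniteField (c ℓ : Level) : Set (lsuc (c ⊔ ℓ)) where
  field
    commRing : CommutativeRing c ℓ
  open CommutativeRing commRing public hiding (ring)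
  field
    1≉0    : ¬ (1# ≈ 0#)
    mulInv : ∀ x → ¬ (x ≈ 0#) → ∃[ y ] (x * y ≈ 1#)
    q      : ℕ
    enum   : Inverse (≡.setoid (Fin q)) setoid

module Shuffle {c ℓ : Level} (𝔽 : FiniteField c ℓ) where
  open FiniteField 𝔽

  ℕ→F : ℕ → Carrier
  ℕ→F zero    = 0#
  ℕ→F (suc n) = 1# + ℕ→F n

  sgn : ℕ → Carrier
  sgn zero    = 1#
  sgn (suc n) = - 1# * sgn n

  Δ : ℕ → ℕ → ℕ → Carrier
  Δ r s j = if does ((q ∸ 1) ∣? j)
            then sgn (r ∸ 1) * ℕ→F ((j ∸ 1) C (r ∸ 1)) + sgn (s ∸ 1) * ℕ→F ((j ∸ 1) C (s ∸ 1))
            else 0#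

  index : Carrier → Fin q
  index = Inverse.from enum

  _==F_ : Carrier → Carrier → Bool
  x ==F y = does (index x Fin.≟ index y)

  F* : Set (c ⊔ ℓ)
  F* = Σ Carrier (λ e → ¬ (e ≈ 0#))

  one* : F*
  one* = 1# , 1≉0

  nonzero-* : ∀ {x y} → ¬ (x ≈ 0#) → ¬ (y ≈ 0#) → ¬ (x * y ≈ 0#)
  nonzero-* {x} {y} x≉0 y≉0 xy≈0 = y≉0 y≈0
    where
    open SetoidReasoning setoid
    x' = proj₁ (mulInv x x≉0)
    xx'≈1 = proj₂ (mulInv x x≉0)
    y≈0 : y ≈ 0#
    y≈0 = begin
      y               ≈⟨ sym (*-identityˡ y) ⟩
      1# * y          ≈⟨ *-congʳ (sym xx'≈1) ⟩
      (x * x') * y    ≈⟨ *-congʳ (*-comm x x') ⟩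
      (x' * x) * y    ≈⟨ *-assoc x' x y ⟩
      x' * (x * y)    ≈⟨ *-congˡ xy≈0 ⟩
      x' * 0#         ≈⟨ zeroʳ x' ⟩
      0#              ∎

  _*⁎_ : F* → F* → F*
  (x , p) *⁎ (y , r) = x * y , nonzero-* p r

  record ℕ⁺ : Set where
    constructor 1+
    field pred : ℕ

  val : ℕ⁺ → ℕ
  val (1+ k) = suc k

  _+⁺_ : ℕ⁺ → ℕ⁺ → ℕ⁺
  1+ a +⁺ 1+ b = 1+ (suc (a ℕ.+ b))

  splits : ℕ⁺ → ℕ⁺ → List (ℕ⁺ × ℕ⁺)
  splits (1+ a) (1+ b) = map (λ k → 1+ ((a ℕ.+ b) ∸ k) , 1+ k) (upTo (suc (a ℕ.+ b)))

  -- An element of the F_q-vector space with basis ⟨L⟩ is represented by a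
  -- list of (coefficient , word) pairs; two representations are equal
  -- (≋) iff every word has the same total coefficient.

  module FreeSpace {a} (L : Set a) (_==L_ : L → L → Bool) where
    Word : Set a
    Word = List L

    Comb : Set (c ⊔ a)
    Comb = List (Carrier × Word)

    _==W_ : Word → Word → Bool
    []      ==W []      = true
    (x ∷ u) ==W (y ∷ v) = (x ==L y) ∧ (u ==W v)
    _       ==W _       = false

    coeff : Word → Comb → Carrier
    coeff w = foldr (λ p acc → if proj₂ p ==W w then proj₁ p + acc else acc) 0#

    infix 4 _≋_
    _≋_ : Comb → Comb → Set (ℓ ⊔ a)
    u ≋ v = ∀ w → coeff w u ≈ coeff w v

    word : Word → Comb
    word w = (1# , w) ∷ []

    scale : Carrier → Comb → Comb
    scale r = map (λ p → r * proj₁ p , proj₂ p)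

    pre : L → Comb → Comb
    pre x = map (λ p → proj₁ p , x ∷ proj₂ p)

    ext : (Word → Comb) → Comb → Comb
    ext f = concatMap (λ p → scale (proj₁ p) (f (proj₂ p)))

  LetterΣ : Set
  LetterΣ = ℕ⁺

  _==Σ_ : LetterΣ → LetterΣ → Bool
  1+ a ==Σ 1+ b = does (a ℕ.≟ b)

  module 𝔠 = FreeSpace LetterΣ _==Σ_
  open 𝔠 using () renaming (Word to WordΣ; Comb to CombΣ)

  mutual
    shΣ : ℕ → WordΣ → WordΣ → CombΣ
    shΣ _ [] v = 𝔠.word v
    shΣ _ u [] = 𝔠.word u
    shΣ zero _ _ = []
    shΣ (suc n) (a ∷ u) (b ∷ v) =
      𝔠.pre a (shΣ n u (b ∷ v)) ++ 𝔠.pre b (shΣ n (a ∷ u) v) ++ diaΣ (suc n) (a ∷ u) (b ∷ v)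

    diaΣ : ℕ → WordΣ → WordΣ → CombΣ
    diaΣ _ [] v = 𝔠.word v
    diaΣ _ u [] = 𝔠.word u
    diaΣ zero _ _ = []
    diaΣ (suc n) (a ∷ u) (b ∷ v) =
      𝔠.pre (a +⁺ b) (shΣ n u v) ++
      concatMap (λ ij → 𝔠.scale (Δ (val a) (val b) (val (proj₂ ij)))
                          (𝔠.pre (proj₁ ij) (𝔠.ext (shΣ n (proj₂ ij ∷ [])) (shΣ n u v))))
                (splits a b)

  -- the products ш and ⋄ on words of 𝔠 (fuel = total length, which is
  -- enough: every recursive call strictly lowers the fuel while the total
  -- length of the arguments stays ≤ the fuel)
  _шΣ_ : WordΣ → WordΣ → CombΣ
  u шΣ v = shΣ (length u ℕ.+ length v) u v

  _⋄Σ_ : WordΣ → WordΣ → CombΣ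
  u ⋄Σ v = diaΣ (length u ℕ.+ length v) u v

  LetterΓ : Set (c ⊔ ℓ)
  LetterΓ = ℕ⁺ × F*

  _==Γ_ : LetterΓ → LetterΓ → Bool
  (1+ a , (e , _)) ==Γ (1+ b , (f , _)) = does (a ℕ.≟ b) ∧ (e ==F f)

  module 𝔇 = FreeSpace LetterΓ _==Γ_
  open 𝔇 using () renaming (Word to WordΓ; Comb to CombΓ)

  mutual
    shΓ : ℕ → WordΓ → WordΓ → CombΓ
    shΓ _ [] v = 𝔇.word v
    shΓ _ u [] = 𝔇.word u
    shΓ zero _ _ = []
    shΓ (suc n) (a ∷ u) (b ∷ v) =
      𝔇.pre a (shΓ n u (b ∷ v)) ++ 𝔇.pre b (shΓ n (a ∷ u) v) ++ diaΓ (suc n) (a ∷ u) (b ∷ v)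

    diaΓ : ℕ → WordΓ → WordΓ → CombΓ
    diaΓ _ [] v = 𝔇.word v
    diaΓ _ u [] = 𝔇.word u
    diaΓ zero _ _ = []
    diaΓ (suc n) ((a , α) ∷ u) ((b , β) ∷ v) =
      𝔇.pre (a +⁺ b , α *⁎ β) (shΓ n u v) ++
      concatMap (λ ij → 𝔇.scale (Δ (val a) (val b) (val (proj₂ ij)))
                          (𝔇.pre (proj₁ ij , α *⁎ β)
                                 (𝔇.ext (shΓ n ((proj₂ ij , one*) ∷ [])) (shΓ n u v))))
                (splits a b)

  _шΓ_ : WordΓ → WordΓ → CombΓ
  u шΓ v = shΓ (length u ℕ.+ length v) u v

  _⋄Γ_ : WordΓ → WordΓ → CombΓ
  u ⋄Γ v = diaΓ (length u ℕ.+ length v) u v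

  φΣw : F* → WordΣ → WordΓ
  φΣw γ []      = []
  φΣw γ (a ∷ u) = (a , γ) ∷ map (λ b → b , one*) u

  φΣ : F* → CombΣ → CombΓ
  φΣ γ = map (λ p → proj₁ p , φΣw γ (proj₂ p))

  φΓw : F* → WordΓ → WordΓ
  φΓw γ []             = []
  φΓw γ ((u , ε) ∷ w)  = (u , γ *⁎ ε) ∷ w

  φΓ : F* → CombΓ → CombΓ
  φΓ γ = map (λ p → proj₁ p , φΓw γ (proj₂ p))

{-# OPTIONS --safe #-}
-- Every word of x_{a,α}𝔞₋ ⋄ x_{b,β}𝔟₋ begins with a letter of label αβ, and
-- apart from that label the product does not involve α and β at all: below
-- the leading letter only ш-products of the tails and letters of label 1
-- occur.  The horizontal maps only rescale the leading label, so both sides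
-- of each identity agree term by term, the leading labels being (αε)(βδ) and
-- (αβ)(εδ).  For words of 𝔠 one additionally checks that the shuffle of 𝔇,
-- restricted to letters of label 1, reproduces the shuffle of 𝔠.
module Submission where

open import Defs
open import Data.List using ([])
open import Data.Product using (_×_)
open import Relation.Binary.PropositionalEquality using (_≢_)

open import Level using (Level; _⊔_)
open import Data.Nat using (zero; suc) renaming (_+_ to _+ℕ_)
open import Data.Bool using (Bool; true; false; _∧_)
open import Data.List using (List; _∷_; map; concatMap; length)
open import Function using (_∘′_)
open import Data.List.Properties using (length-map)
open import Data.Product using (_,_; proj₁; proj₂)
import Data.Product as Product
open import Data.List.Relation.Binary.Pointwise as Pointwise
  using (Pointwise; []; _∷_; ++⁺; concat⁺; map⁺)
open import Function.Bundles using (Inverse)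
open import Relation.Nullary using (contradiction)
open import Relation.Binary.PropositionalEquality as ≡ using (_≡_; refl)
import Algebra.Properties.CommutativeSemigroup as CommutativeSemigroupProperties

module HorizontalMaps {c ℓ : Level} (𝔽 : FiniteField c ℓ) where
  open FiniteField 𝔽 renaming (refl to ≈-refl; trans to ≈-trans)
  open Shuffle 𝔽
  open 𝔇 using () renaming (Word to WordΓ)
  open 𝔠 using () renaming (Word to WordΣ)

  label : LetterΓ → Carrier
  label x = proj₁ (proj₂ x)

  module _ {a b : Level} {A : Set a} {B : Set b} where

    TermRel : ∀ {r} → (List A → List B → Set r) →
      Carrier × List A → Carrier × List B → Set (ℓ ⊔ r)
    TermRel W p q = (proj₁ p ≈ proj₁ q) × W (proj₂ p) (proj₂ q)

    CombRel : ∀ {r} → (List A → List B → Set r) →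
      List (Carrier × List A) → List (Carrier × List B) → Set (c ⊔ a ⊔ b ⊔ ℓ ⊔ r)
    CombRel W = Pointwise (TermRel W)

    module FreeSpaceCong (_==A_ : A → A → Bool) (_==B_ : B → B → Bool) where
      private
        module SA = FreeSpace A _==A_
        module SB = FreeSpace B _==B_

      pre-cong : ∀ {r r'} {W : List A → List B → Set r} {W' : List A → List B → Set r'}
        {x y c d} → (∀ {u v} → W u v → W' (x ∷ u) (y ∷ v)) →
        CombRel W c d → CombRel W' (SA.pre x c) (SB.pre y d)
      pre-cong head = map⁺ _ _ ∘′ Pointwise.map (Product.map₂ head)

      scale-cong : ∀ {w} {W : List A → List B → Set w} {r s c d} → r ≈ s →
        CombRel W c d → CombRel W (SA.scale r c) (SB.scale s d)
      scale-cong r≈s = map⁺ _ _ ∘′ Pointwise.map (Product.map₁ (*-cong r≈s))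

      ext-cong : ∀ {r r'} {W : List A → List B → Set r} {W' : List A → List B → Set r'}
        {F G c d} → (∀ {u v} → W u v → CombRel W' (F u) (G v)) →
        CombRel W c d → CombRel W' (SA.ext F c) (SB.ext G d)
      ext-cong FG = concat⁺ ∘′ map⁺ _ _ ∘′ Pointwise.map λ (r≈s , uWv) →
        scale-cong r≈s (FG uWv)

    concatMap-cong : ∀ {i r} {I : Set i} {W : List A → List B → Set r}
      {F : I → List (Carrier × List A)} {G : I → List (Carrier × List B)} →
      (∀ k → CombRel W (F k) (G k)) → ∀ ks → CombRel W (concatMap F ks) (concatMap G ks)
    concatMap-cong FG ks = concat⁺ (map⁺ _ _ (Pointwise.refl (λ {k} → FG k) {ks}))

  CombRel-mapʳ : ∀ {a b c' r} {A : Set a} {B : Set b} {C : Set c'} {W : List A → List C → Set r}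
    (φ : List B → List C) {cs ds} → CombRel (λ u v → W u (φ v)) cs ds →
    CombRel W cs (map (λ p → proj₁ p , φ (proj₂ p)) ds)
  CombRel-mapʳ φ []           = []
  CombRel-mapʳ φ (rel ∷ rels) = rel ∷ CombRel-mapʳ φ rels


  _≈ᴸ_ : LetterΓ → LetterΓ → Set ℓ
  x ≈ᴸ y = (proj₁ x ≡ proj₁ y) × (label x ≈ label y)

  _≈ᵂ_ : WordΓ → WordΓ → Set (c ⊔ ℓ)
  _≈ᵂ_ = Pointwise _≈ᴸ_

  ≈ᵂ-refl : ∀ {w} → w ≈ᵂ w
  ≈ᵂ-refl = Pointwise.refl (refl , ≈-refl)

  ==Γ-cong : ∀ {x y} z → x ≈ᴸ y → (x ==Γ z) ≡ (y ==Γ z)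
  ==Γ-cong {_ , (e , _)} {_ , (f , _)} _ (refl , e≈f)
    rewrite Inverse.from-cong enum e≈f = refl

  ==W-cong : ∀ {u v} w → u ≈ᵂ v → (u 𝔇.==W w) ≡ (v 𝔇.==W w)
  ==W-cong []      []       = refl
  ==W-cong (_ ∷ _) []       = refl
  ==W-cong []      (_ ∷ _)  = refl
  ==W-cong {x ∷ _} {y ∷ _} (z ∷ w) (x≈y ∷ u≈v) =
    ≡.cong₂ _∧_ (==Γ-cong {x} {y} z x≈y) (==W-cong w u≈v)

  coeff-cong : ∀ w {c d} → CombRel _≈ᵂ_ c d → 𝔇.coeff w c ≈ 𝔇.coeff w d
  coeff-cong w [] = ≈-refl
  coeff-cong w {(_ , u) ∷ _} {(_ , v) ∷ _} ((r≈s , u≈v) ∷ c≈d)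
    rewrite ==W-cong w u≈v with v 𝔇.==W w
  ... | true  = +-cong r≈s (coeff-cong w c≈d)
  ... | false = coeff-cong w c≈d

  CombRel-≈ᵂ⇒≋ : ∀ {c d} → CombRel _≈ᵂ_ c d → c 𝔇.≋ d
  CombRel-≈ᵂ⇒≋ c≈d w = coeff-cong w c≈d

  -- Only ≈ 1, not ≡ one*: the leading letter of a ⋄-product of such letters has label 1 * 1.
  _≈ᴸΣ_ : LetterΓ → LetterΣ → Set ℓ
  x ≈ᴸΣ y = (proj₁ x ≡ y) × (label x ≈ 1#)

  _≈ᵂΣ_ : WordΓ → WordΣ → Set (c ⊔ ℓ)
  _≈ᵂΣ_ = Pointwise _≈ᴸΣ_

  Σ→Γ : LetterΣ → LetterΓ
  Σ→Γ y = y , one*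

  ≈ᵂΣ⇒≈ᵂ : ∀ {u' u} → u' ≈ᵂΣ u → u' ≈ᵂ map Σ→Γ u
  ≈ᵂΣ⇒≈ᵂ []                  = []
  ≈ᵂΣ⇒≈ᵂ ((refl , l≈1) ∷ ps) = (refl , l≈1) ∷ ≈ᵂΣ⇒≈ᵂ ps

  Σ→Γ-≈ᵂΣ : ∀ u → map Σ→Γ u ≈ᵂΣ u
  Σ→Γ-≈ᵂΣ []      = []
  Σ→Γ-≈ᵂΣ (_ ∷ u) = (refl , ≈-refl) ∷ Σ→Γ-≈ᵂΣ u

  module ΓΣ = FreeSpaceCong _==Γ_ _==Σ_
  module ΓΓ = FreeSpaceCong _==Γ_ _==Γ_

  *-≈1 : ∀ {x y} → x ≈ 1# → y ≈ 1# → x * y ≈ 1#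
  *-≈1 x≈1 y≈1 = ≈-trans (*-cong x≈1 y≈1) (*-identityˡ 1#)

  mutual
    shΓ-simulates-shΣ : ∀ n {u' v' u v} → u' ≈ᵂΣ u → v' ≈ᵂΣ v →
      CombRel _≈ᵂΣ_ (shΓ n u' v') (shΣ n u v)
    shΓ-simulates-shΣ n       []       v'≈v     = (≈-refl , v'≈v) ∷ []
    shΓ-simulates-shΣ n       (p ∷ ps) []       = (≈-refl , p ∷ ps) ∷ []
    shΓ-simulates-shΣ zero    (_ ∷ _)  (_ ∷ _)  = []
    shΓ-simulates-shΣ (suc n) {u'} {v'} {u} {v} (p ∷ ps) (q ∷ qs) =
      ++⁺ (ΓΣ.pre-cong (p ∷_) (shΓ-simulates-shΣ n ps (q ∷ qs)))
     (++⁺ (ΓΣ.pre-cong (q ∷_) (shΓ-simulates-shΣ n (p ∷ ps) qs))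
          (diaΓ-simulates-diaΣ (suc n) {u'} {v'} {u} {v} (p ∷ ps) (q ∷ qs)))

    diaΓ-simulates-diaΣ : ∀ n {u' v' u v} → u' ≈ᵂΣ u → v' ≈ᵂΣ v →
      CombRel _≈ᵂΣ_ (diaΓ n u' v') (diaΣ n u v)
    diaΓ-simulates-diaΣ n       []       v'≈v     = (≈-refl , v'≈v) ∷ []
    diaΓ-simulates-diaΣ n       (p ∷ ps) []       = (≈-refl , p ∷ ps) ∷ []
    diaΓ-simulates-diaΣ zero    (_ ∷ _)  (_ ∷ _)  = []
    diaΓ-simulates-diaΣ (suc n) {(a , α) ∷ _} {(b , β) ∷ _}
                        ((refl , α≈1) ∷ ps) ((refl , β≈1) ∷ qs) =
      ++⁺ (ΓΣ.pre-cong (head ∷_) tails)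
          (concatMap-cong (λ _ → ΓΣ.scale-cong ≈-refl (ΓΣ.pre-cong (head ∷_)
            (ΓΣ.ext-cong (shΓ-simulates-shΣ n ((refl , ≈-refl) ∷ [])) tails))) (splits a b))
      where
      tails = shΓ-simulates-shΣ n ps qs
      head : ∀ {i} → (i , α *⁎ β) ≈ᴸΣ i
      head = refl , *-≈1 α≈1 β≈1

  diaΓ-leading-label : ∀ n a b u v (α β α' β' γ : F*) →
    proj₁ (α *⁎ β) ≈ proj₁ (γ *⁎ (α' *⁎ β')) →
    CombRel _≈ᵂ_ (diaΓ (suc n) ((a , α) ∷ u) ((b , β) ∷ v))
                 (φΓ γ (diaΓ (suc n) ((a , α') ∷ u) ((b , β') ∷ v)))
  diaΓ-leading-label n a b u v α β α' β' γ labels =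
    CombRel-mapʳ (φΓw γ) (++⁺ (ΓΓ.pre-cong head (same tails))
      (concatMap-cong (λ ij → ΓΓ.scale-cong ≈-refl (ΓΓ.pre-cong head
        (same (𝔇.ext (shΓ n ((proj₂ ij , one*) ∷ [])) tails)))) (splits a b)))
    where
    tails = shΓ n u v
    same : ∀ c → CombRel _≡_ c c
    same _ = Pointwise.refl (≈-refl , refl)
    head : ∀ {i w w'} → w ≡ w' → ((i , α *⁎ β) ∷ w) ≈ᵂ φΓw γ ((i , α' *⁎ β') ∷ w')
    head refl = (refl , labels) ∷ ≈ᵂ-refl

  diaΓ-φΣ-diaΣ : ∀ n a b {u' v' u v} (α β : F*) → u' ≈ᵂΣ u → v' ≈ᵂΣ v →
    CombRel _≈ᵂ_ (diaΓ (suc n) ((a , α) ∷ u') ((b , β) ∷ v'))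
                 (φΣ (α *⁎ β) (diaΣ (suc n) (a ∷ u) (b ∷ v)))
  diaΓ-φΣ-diaΣ n a b α β u'≈u v'≈v =
    CombRel-mapʳ (φΣw (α *⁎ β)) (++⁺ (ΓΣ.pre-cong head tails)
      (concatMap-cong (λ _ → ΓΣ.scale-cong ≈-refl (ΓΣ.pre-cong head
        (ΓΣ.ext-cong (shΓ-simulates-shΣ n ((refl , ≈-refl) ∷ [])) tails))) (splits a b)))
    where
    tails = shΓ-simulates-shΣ n u'≈u v'≈v
    head : ∀ {i w' w} → w' ≈ᵂΣ w → ((i , α *⁎ β) ∷ w') ≈ᵂ φΣw (α *⁎ β) (i ∷ w)
    head w'≈w = (refl , ≈-refl) ∷ ≈ᵂΣ⇒≈ᵂ w'≈w

  -- ⋄Γ and ⋄Σ run on fuel = total length, which φΣw preserves only up to length-map.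
  φΣw-⋄Γ : ∀ α β a b u v → φΣw α (a ∷ u) ⋄Γ φΣw β (b ∷ v) ≡
    diaΓ (suc (length u +ℕ suc (length v))) ((a , α) ∷ map Σ→Γ u) ((b , β) ∷ map Σ→Γ v)
  φΣw-⋄Γ α β a b u v =
    ≡.cong (λ n → diaΓ (suc n) ((a , α) ∷ map Σ→Γ u) ((b , β) ∷ map Σ→Γ v))
    (≡.cong₂ (λ m k → m +ℕ suc k) (length-map Σ→Γ u) (length-map Σ→Γ v))

  horizontal-⋄Σ : (α β : F*) (a b : WordΣ) → a ≢ [] → b ≢ [] →
    (φΣw α a ⋄Γ φΣw β b) 𝔇.≋ φΣ (α *⁎ β) (a ⋄Σ b)
  horizontal-⋄Σ α β []      _       a≢[] _    = contradiction refl a≢[]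
  horizontal-⋄Σ α β (_ ∷ _) []      _    b≢[] = contradiction refl b≢[]
  horizontal-⋄Σ α β (a ∷ u) (b ∷ v) _    _
    rewrite φΣw-⋄Γ α β a b u v =
    CombRel-≈ᵂ⇒≋ (diaΓ-φΣ-diaΣ _ a b α β (Σ→Γ-≈ᵂΣ u) (Σ→Γ-≈ᵂΣ v))

  horizontal-⋄Γ : (α β : F*) (a b : WordΓ) → a ≢ [] → b ≢ [] →
    (φΓw α a ⋄Γ φΓw β b) 𝔇.≋ φΓ (α *⁎ β) (a ⋄Γ b)
  horizontal-⋄Γ α β []      _       a≢[] _    = contradiction refl a≢[]
  horizontal-⋄Γ α β (_ ∷ _) []      _    b≢[] = contradiction refl b≢[]
  horizontal-⋄Γ α β ((a , ε) ∷ u) ((b , δ) ∷ v) _ _ =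
    CombRel-≈ᵂ⇒≋ (diaΓ-leading-label _ a b u v (α *⁎ ε) (β *⁎ δ) ε δ (α *⁎ β)
      (interchange _ _ _ _))
    where open CommutativeSemigroupProperties *-commutativeSemigroup using (interchange)

lemma5p4 : ∀ {c ℓ} (𝔽 : FiniteField c ℓ) → let open Shuffle 𝔽 in
    (α β : F*) →
    ((a b : 𝔠.Word) → a ≢ [] → b ≢ [] →
    (φΣw α a ⋄Γ φΣw β b) 𝔇.≋ φΣ (α *⁎ β) (a ⋄Σ b))
    × ((a b : 𝔇.Word) → a ≢ [] → b ≢ [] →
    (φΓw α a ⋄Γ φΓw β b) 𝔇.≋ φΓ (α *⁎ β) (a ⋄Γ b))
lemma5p4 𝔽 α β = horizontal-⋄Σ α β , horizontal-⋄Γ α β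
  where open HorizontalMaps 𝔽
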